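{- Let $X,k\ge0$ be integers. Then $$\sum_{j=0}^{\lfloor k/2\rfloor}(-1)^j2^{k-2j}\binom{k-j}{j}\binom{X+k-j}{k-j}=\binom{2X+k+1}{k}.$$ -}

module Defs where

open import Data.Nat using (ℕ; zero; suc)
open import Data.Integer using (ℤ; _+_; +_; -_)
open import Data.Integer using () renaming (_^_ to _^ℤ_)

sumTo : ℕ → (ℕ → ℤ) → ℤ
sumTo zero    f = f 0
sumTo (suc n) f = sumTo n f + f (suc n)

sign : ℕ → ℤ
sign j = (- (+ 1)) ^ℤ j

module Submission where

-- Write c(m,j) = (-1)^j 2^(m-j) C(m,j) for the coefficient of
-- t^(m+j) in (2t - t²)^m, and for a sequence a let
--   Sub a k = Σ_{m+j=k} c(m,j) a(m)  =  [t^k] Σ_m a(m) (2t - t²)^m .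
-- Reindexing by m = k - j, the left-hand side of the theorem is Sub a k for
-- the multiset coefficients a(m) = C(X+m, m) (terms with j > k/2 vanish),
-- i.e. the k-th coefficient of (1-u)^-(X+1) at u = 2t - t², which is
-- (1-t)^-(2X+2); the right-hand side is exactly that coefficient.
-- Without power series, the argument runs on recurrences.  Multiplying by
-- 2t - t² gives c(m+1,j+1) = 2 c(m,j+1) - c(m,j), hence for every a
--   Sub a (k+2) = 2 Sub a' (k+1) - Sub a' k,   a' the shifted sequence.
-- Pascal's rule splits a' into a plus the multiset coefficients for X-1
-- (or 0 when X = 0); by a lexicographic induction on (X,k) both sides
-- satisfy the same second-order recurrence C(n+2,k+2) = 2 C(n+1,k+1)
-- - C(n,k) + C(n,k+2) with the same initial values, which proves the theorem.

open import Defs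
open import Data.Nat using (ℕ; _∸_; _/_)
open import Data.Nat.Combinatorics using (_C_)
open import Data.Integer using (ℤ; +_; _*_)
open import Relation.Binary.PropositionalEquality using (_≡_)
import Data.Nat as N

open import Data.Nat using (zero; suc; _≤_; _<_; _%_; z≤n; s≤s; _<?_)
open import Data.Nat.Combinatorics using (k>n⇒nCk≡0; nC1≡n; nCk+nC[k+1]≡[n+1]C[k+1])
open import Data.Nat.DivMod using (m≡m%n+[m/n]*n; m%n<n; m/n≤m)
import Data.Nat.Properties as NP
import Data.Nat.Tactic.RingSolver as NSolver
open import Data.Integer using (_+_; _-_; -_)
import Data.Integer.Properties as ZP
open import Data.Integer.Tactic.RingSolver using (solve-∀)
open import Data.Sum using (inj₁; inj₂)
open import Relation.Nullary using (yes; no)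
open import Relation.Binary.PropositionalEquality
  using (refl; sym; trans; cong; cong₂; module ≡-Reasoning)

-- Beyond ⌊k/2⌋ an index i satisfies k - i < i; this kills the terms j > k/2.
k/2<i⇒k<i+i : ∀ k i → k / 2 < i → k < i N.+ i
k/2<i⇒k<i+i k i lt = begin-strict
  k                          ≡⟨ m≡m%n+[m/n]*n k 2 ⟩
  k % 2 N.+ (k / 2) N.* 2    <⟨ NP.+-monoˡ-< ((k / 2) N.* 2) (m%n<n k 2) ⟩
  suc (k / 2) N.* 2          ≤⟨ NP.*-monoˡ-≤ 2 lt ⟩
  i N.* 2                    ≡⟨ NP.*-comm i 2 ⟩
  2 N.* i                    ≡⟨ cong (i N.+_) (NP.+-identityʳ i) ⟩
  i N.+ i                    ∎
  where open NP.≤-Reasoning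

open ≡-Reasoning

sumTo-cong : ∀ k (f g : ℕ → ℤ) → (∀ i → i ≤ k → f i ≡ g i) → sumTo k f ≡ sumTo k g
sumTo-cong zero    f g f≗g = f≗g 0 z≤n
sumTo-cong (suc k) f g f≗g =
  cong₂ _+_ (sumTo-cong k f g (λ i i≤k → f≗g i (NP.m≤n⇒m≤1+n i≤k))) (f≗g (suc k) NP.≤-refl)

sumTo-truncate : ∀ {n} k (f : ℕ → ℤ) → n ≤ k →
                 (∀ i → n < i → i ≤ k → f i ≡ + 0) → sumTo k f ≡ sumTo n f
sumTo-truncate zero f z≤n _ = refl
sumTo-truncate {n} (suc k) f n≤k vanish with NP.m≤n⇒m<n∨m≡n n≤k
... | inj₂ refl = refl
... | inj₁ (s≤s n≤k′) = begin
  sumTo k f + f (suc k)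
    ≡⟨ cong₂ _+_ (sumTo-truncate k f n≤k′ vanish′) (vanish (suc k) (s≤s n≤k′) NP.≤-refl) ⟩
  sumTo n f + + 0       ≡⟨ ZP.+-identityʳ _ ⟩
  sumTo n f             ∎
  where
  vanish′ : ∀ i → n < i → i ≤ k → f i ≡ + 0
  vanish′ i n<i i≤k = vanish i n<i (NP.m≤n⇒m≤1+n i≤k)

-- Antidiagonal sums: antidiag k F = Σ_{m+j=k} F m j, built by shifting m.
antidiag : ℕ → (ℕ → ℕ → ℤ) → ℤ
antidiag zero    F = F 0 0
antidiag (suc k) F = antidiag k (λ m j → F (suc m) j) + F 0 (suc k)

antidiag-cong : ∀ k (F G : ℕ → ℕ → ℤ) → (∀ m j → F m j ≡ G m j) → antidiag k F ≡ antidiag k G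
antidiag-cong zero    F G F≗G = F≗G 0 0
antidiag-cong (suc k) F G F≗G =
  cong₂ _+_ (antidiag-cong k _ _ (λ m j → F≗G (suc m) j)) (F≗G 0 (suc k))

antidiag-zero : ∀ k (F : ℕ → ℕ → ℤ) → (∀ m j → F m j ≡ + 0) → antidiag k F ≡ + 0
antidiag-zero zero    F F≗0 = F≗0 0 0
antidiag-zero (suc k) F F≗0 =
  cong₂ _+_ (antidiag-zero k _ (λ m j → F≗0 (suc m) j)) (F≗0 0 (suc k))

antidiag-+ : ∀ k (F G : ℕ → ℕ → ℤ) →
             antidiag k (λ m j → F m j + G m j) ≡ antidiag k F + antidiag k G
antidiag-+ zero    F G = refl
antidiag-+ (suc k) F G = begin
  antidiag k (λ m j → F (suc m) j + G (suc m) j) + (F 0 (suc k) + G 0 (suc k))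
    ≡⟨ cong (_+ (F 0 (suc k) + G 0 (suc k))) (antidiag-+ k _ _) ⟩
  (antidiag k (λ m j → F (suc m) j) + antidiag k (λ m j → G (suc m) j)) + (F 0 (suc k) + G 0 (suc k))
    ≡⟨ interchange (antidiag k (λ m j → F (suc m) j)) (antidiag k (λ m j → G (suc m) j))
                   (F 0 (suc k)) (G 0 (suc k)) ⟩
  antidiag (suc k) F + antidiag (suc k) G ∎
  where
  interchange : ∀ a b c d → (a + b) + (c + d) ≡ (a + c) + (b + d)
  interchange = solve-∀

antidiag-* : ∀ k c (F : ℕ → ℕ → ℤ) → antidiag k (λ m j → c * F m j) ≡ c * antidiag k F
antidiag-* zero    c F = refl
antidiag-* (suc k) c F =
  trans (cong (_+ c * F 0 (suc k)) (antidiag-* k c _)) (sym (ZP.*-distribˡ-+ c _ _))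

antidiag-peel : ∀ k F → antidiag (suc k) F ≡ F (suc k) 0 + antidiag k (λ m j → F m (suc j))
antidiag-peel zero    F = refl
antidiag-peel (suc k) F = begin
  antidiag (suc k) (λ m j → F (suc m) j) + F 0 (suc (suc k))
    ≡⟨ cong (_+ F 0 (suc (suc k))) (antidiag-peel k (λ m j → F (suc m) j)) ⟩
  (F (suc (suc k)) 0 + antidiag k (λ m j → F (suc m) (suc j))) + F 0 (suc (suc k))
    ≡⟨ ZP.+-assoc (F (suc (suc k)) 0) (antidiag k (λ m j → F (suc m) (suc j))) (F 0 (suc (suc k))) ⟩
  F (suc (suc k)) 0 + antidiag (suc k) (λ m j → F m (suc j)) ∎

antidiag-sumTo : ∀ k F → antidiag k F ≡ sumTo k (λ j → F (k ∸ j) j)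
antidiag-sumTo zero    F = refl
antidiag-sumTo (suc k) F = cong₂ _+_
  (trans (antidiag-sumTo k _)
         (sumTo-cong k _ _ (λ j j≤k → cong (λ m → F m j) (sym (NP.+-∸-assoc 1 j≤k)))))
  (cong (λ m → F m (suc k)) (sym (NP.n∸n≡0 k)))

-- The coefficients c(m,j) = (-1)^j 2^(m-j) C(m,j) of t^(m+j) in (2t - t²)^m.
coeff : ℕ → ℕ → ℤ
coeff m j = sign j * + (2 N.^ (m ∸ j) N.* (m C j))

coeff-vanishes : ∀ {m j} → m < j → coeff m j ≡ + 0
coeff-vanishes {m} {j} m<j = begin
  sign j * + (2 N.^ (m ∸ j) N.* (m C j)) ≡⟨ cong (λ c → sign j * + (2 N.^ (m ∸ j) N.* c)) (k>n⇒nCk≡0 m<j) ⟩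
  sign j * + (2 N.^ (m ∸ j) N.* 0)       ≡⟨ cong (λ x → sign j * + x) (NP.*-zeroʳ (2 N.^ (m ∸ j))) ⟩
  sign j * + 0                           ≡⟨ ZP.*-zeroʳ (sign j) ⟩
  + 0                                    ∎

coeff-0-suc : ∀ j → coeff 0 (suc j) ≡ + 0
coeff-0-suc j = coeff-vanishes {0} {suc j} (s≤s z≤n)

coeff-suc-0 : ∀ m → coeff (suc m) 0 ≡ + 2 * coeff m 0
coeff-suc-0 m = begin
  + 1 * + (2 N.* 2 N.^ m N.* 1)   ≡⟨ ZP.*-identityˡ _ ⟩
  + (2 N.* 2 N.^ m N.* 1)         ≡⟨ cong +_ (NP.*-assoc 2 (2 N.^ m) 1) ⟩
  + (2 N.* (2 N.^ m N.* 1))       ≡⟨ ZP.pos-* 2 (2 N.^ m N.* 1) ⟩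
  + 2 * + (2 N.^ m N.* 1)         ≡⟨ cong (+ 2 *_) (ZP.*-identityˡ _) ⟨
  + 2 * coeff m 0                 ∎

-- One factor 2 of 2^(m-j) is absorbed into 2^(m-(j+1)), unless C(m,j+1) = 0.
double-weight : ∀ m j → 2 N.* (2 N.^ (m ∸ suc j) N.* (m C suc j)) ≡ 2 N.^ (m ∸ j) N.* (m C suc j)
double-weight m j with j <? m
... | yes j<m = begin
  2 N.* (2 N.^ (m ∸ suc j) N.* (m C suc j)) ≡⟨ NP.*-assoc 2 (2 N.^ (m ∸ suc j)) (m C suc j) ⟨
  2 N.^ suc (m ∸ suc j) N.* (m C suc j)     ≡⟨ cong (λ e → 2 N.^ e N.* (m C suc j)) (NP.+-∸-assoc 1 j<m) ⟨
  2 N.^ (m ∸ j) N.* (m C suc j)             ∎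
... | no j≮m rewrite k>n⇒nCk≡0 (s≤s (NP.≮⇒≥ j≮m)) =
  trans (cong (2 N.*_) (NP.*-zeroʳ (2 N.^ (m ∸ suc j)))) (sym (NP.*-zeroʳ (2 N.^ (m ∸ j))))

weighted-pascal : ∀ m j → 2 N.^ (m ∸ j) N.* (suc m C suc j)
                  ≡ 2 N.* (2 N.^ (m ∸ suc j) N.* (m C suc j)) N.+ 2 N.^ (m ∸ j) N.* (m C j)
weighted-pascal m j = begin
  P N.* (suc m C suc j)            ≡⟨ cong (P N.*_) (nCk+nC[k+1]≡[n+1]C[k+1] m j) ⟨
  P N.* (m C j N.+ m C suc j)      ≡⟨ NP.*-distribˡ-+ P (m C j) (m C suc j) ⟩
  P N.* (m C j) N.+ P N.* (m C suc j) ≡⟨ NP.+-comm (P N.* (m C j)) (P N.* (m C suc j)) ⟩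
  P N.* (m C suc j) N.+ P N.* (m C j) ≡⟨ cong (N._+ P N.* (m C j)) (double-weight m j) ⟨
  2 N.* (2 N.^ (m ∸ suc j) N.* (m C suc j)) N.+ P N.* (m C j) ∎
  where P = 2 N.^ (m ∸ j)

-- Multiplication by 2t - t²:  c(m+1,j+1) = 2 c(m,j+1) - c(m,j).
coeff-step : ∀ m j → coeff (suc m) (suc j) ≡ + 2 * coeff m (suc j) - coeff m j
coeff-step m j = begin
  sign (suc j) * + (2 N.^ (m ∸ j) N.* (suc m C suc j))
    ≡⟨ cong (λ x → sign (suc j) * + x) (weighted-pascal m j) ⟩
  sign (suc j) * + (2 N.* Q N.+ PA)
    ≡⟨ cong (sign (suc j) *_) (trans (ZP.pos-+ (2 N.* Q) PA) (cong (_+ + PA) (ZP.pos-* 2 Q))) ⟩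
  sign (suc j) * (+ 2 * + Q + + PA)
    ≡⟨ regroup (sign j) (+ Q) (+ PA) ⟩
  + 2 * coeff m (suc j) - coeff m j ∎
  where
  Q  = 2 N.^ (m ∸ suc j) N.* (m C suc j)
  PA = 2 N.^ (m ∸ j) N.* (m C j)
  regroup : ∀ s q p → (- + 1 * s) * (+ 2 * q + p) ≡ + 2 * ((- + 1 * s) * q) - s * p
  regroup = solve-∀

Sub : (ℕ → ℤ) → ℕ → ℤ
Sub a k = antidiag k (λ m j → coeff m j * a m)

shift : (ℕ → ℤ) → ℕ → ℤ
shift a m = a (suc m)

Δ : (ℕ → ℤ) → ℕ → ℤ
Δ a k = + 2 * Sub a (suc k) - Sub a k

Sub-0 : ∀ a → Sub a 0 ≡ a 0
Sub-0 a = ZP.*-identityˡ (a 0)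

Sub-1 : ∀ a → Sub a 1 ≡ + 2 * a 1
Sub-1 a = begin
  coeff 1 0 * a 1 + coeff 0 1 * a 0 ≡⟨ cong₂ _+_ (cong (_* a 1) (coeff-suc-0 0)) (cong (_* a 0) (coeff-0-suc 0)) ⟩
  + 2 * + 1 * a 1 + + 0 * a 0       ≡⟨ ZP.+-identityʳ _ ⟩
  + 2 * a 1                         ∎

Sub-cong : ∀ a b k → (∀ m → a m ≡ b m) → Sub a k ≡ Sub b k
Sub-cong a b k a≗b = antidiag-cong k _ _ (λ m j → cong (coeff m j *_) (a≗b m))

Sub-zero : ∀ a k → (∀ m → a m ≡ + 0) → Sub a k ≡ + 0
Sub-zero a k a≗0 = antidiag-zero k _ (λ m j → trans (cong (coeff m j *_) (a≗0 m)) (ZP.*-zeroʳ (coeff m j)))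

Sub-+ : ∀ a b d k → (∀ m → a m ≡ b m + d m) → Sub a k ≡ Sub b k + Sub d k
Sub-+ a b d k a≗b+d = trans
  (antidiag-cong k _ _ (λ m j → trans (cong (coeff m j *_) (a≗b+d m)) (ZP.*-distribˡ-+ (coeff m j) _ _)))
  (antidiag-+ k _ _)

Δ-+ : ∀ a b d k → (∀ m → a m ≡ b m + d m) → Δ a k ≡ Δ b k + Δ d k
Δ-+ a b d k a≗b+d = begin
  + 2 * Sub a (suc k) - Sub a k
    ≡⟨ cong₂ (λ x y → + 2 * x - y) (Sub-+ a b d (suc k) a≗b+d) (Sub-+ a b d k a≗b+d) ⟩
  + 2 * (Sub b (suc k) + Sub d (suc k)) - (Sub b k + Sub d k)
    ≡⟨ regroup (Sub b (suc k)) (Sub d (suc k)) (Sub b k) (Sub d k) ⟩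
  Δ b k + Δ d k ∎
  where
  regroup : ∀ p q r s → + 2 * (p + q) - (r + s) ≡ (+ 2 * p - r) + (+ 2 * q - s)
  regroup = solve-∀

Sub-step : ∀ a k → Sub a (suc (suc k)) ≡ Δ (shift a) k
Sub-step a k = begin
  antidiag (suc k) G + coeff 0 (suc (suc k)) * a 0
    ≡⟨ cong₂ _+_ (antidiag-peel k G) (cong (_* a 0) (coeff-0-suc (suc k))) ⟩
  (G (suc k) 0 + antidiag k (λ m j → G m (suc j))) + + 0 * a 0
    ≡⟨ cong₂ (λ x y → (x + y) + + 0 * a 0) (cong (_* a′ (suc k)) (coeff-suc-0 (suc k))) inner ⟩
  ((+ 2 * coeff (suc k) 0) * a′ (suc k) + (+ 2 * antidiag k H + (- + 1) * Sub a′ k)) + + 0 * a 0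
    ≡⟨ regroup (coeff (suc k) 0) (a′ (suc k)) (antidiag k H) (Sub a′ k) (a 0) ⟩
  + 2 * (coeff (suc k) 0 * a′ (suc k) + antidiag k H) - Sub a′ k
    ≡⟨ cong (λ x → + 2 * x - Sub a′ k) (antidiag-peel k (λ m j → coeff m j * a′ m)) ⟨
  Δ a′ k ∎
  where
  a′ = shift a
  G H : ℕ → ℕ → ℤ
  G m j = coeff (suc m) j * a′ m
  H m j = coeff m (suc j) * a′ m
  expand : ∀ x y z → (+ 2 * x - y) * z ≡ + 2 * (x * z) + (- + 1) * (y * z)
  expand = solve-∀
  regroup : ∀ c x y s z → ((+ 2 * c) * x + (+ 2 * y + (- + 1) * s)) + + 0 * z ≡ + 2 * (c * x + y) - s
  regroup = solve-∀
  inner : antidiag k (λ m j → G m (suc j)) ≡ + 2 * antidiag k H + (- + 1) * Sub a′ k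
  inner = begin
    antidiag k (λ m j → G m (suc j))
      ≡⟨ antidiag-cong k _ _ (λ m j → trans (cong (_* a′ m) (coeff-step m j))
                                             (expand (coeff m (suc j)) (coeff m j) (a′ m))) ⟩
    antidiag k (λ m j → + 2 * H m j + (- + 1) * (coeff m j * a′ m))
      ≡⟨ antidiag-+ k _ _ ⟩
    antidiag k (λ m j → + 2 * H m j) + antidiag k (λ m j → (- + 1) * (coeff m j * a′ m))
      ≡⟨ cong₂ _+_ (antidiag-* k (+ 2) H) (antidiag-* k (- + 1) _) ⟩
    + 2 * antidiag k H + (- + 1) * Sub a′ k ∎

-- Multiset coefficients C(X+m, m) (the series (1-u)^-(X+1)) and the Pascal
-- remainder C(X+m, m+1), which is 0 for X = 0 and C(Y+m+1, m+1) for X = Y+1.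
multiset : ℕ → ℕ → ℤ
multiset X m = + ((X N.+ m) C m)

remainder : ℕ → ℕ → ℤ
remainder X m = + ((X N.+ m) C suc m)

multiset-pascal : ∀ X m → shift (multiset X) m ≡ multiset X m + remainder X m
multiset-pascal X m = begin
  + ((X N.+ suc m) C suc m)                 ≡⟨ cong (λ n → + (n C suc m)) (NP.+-suc X m) ⟩
  + (suc (X N.+ m) C suc m)                 ≡⟨ cong +_ (nCk+nC[k+1]≡[n+1]C[k+1] (X N.+ m) m) ⟨
  + ((X N.+ m) C m N.+ (X N.+ m) C suc m)   ≡⟨ ZP.pos-+ ((X N.+ m) C m) ((X N.+ m) C suc m) ⟩
  multiset X m + remainder X m              ∎

remainder-0 : ∀ m → remainder 0 m ≡ + 0
remainder-0 m = cong +_ (k>n⇒nCk≡0 (NP.n<1+n m))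

remainder-suc : ∀ Y m → remainder (suc Y) m ≡ shift (multiset Y) m
remainder-suc Y m = cong (λ n → + (n C suc m)) (sym (NP.+-suc Y m))

pascal-second : ∀ n k → + 2 * + (suc n C suc k) - + (n C k) + + (n C suc (suc k))
                        ≡ + (suc (suc n) C suc (suc k))
pascal-second n k = begin
  + 2 * + (suc n C suc k) - c + e   ≡⟨ cong (λ x → + 2 * x - c + e) (pascalℤ n k) ⟩
  + 2 * (c + d) - c + e             ≡⟨ regroup c d e ⟩
  (c + d) + (d + e)                 ≡⟨ cong₂ _+_ (pascalℤ n k) (pascalℤ n (suc k)) ⟨
  + (suc n C suc k) + + (suc n C suc (suc k)) ≡⟨ pascalℤ (suc n) (suc k) ⟨
  + (suc (suc n) C suc (suc k))     ∎
  where
  c = + (n C k)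
  d = + (n C suc k)
  e = + (n C suc (suc k))
  pascalℤ : ∀ n k → + (suc n C suc k) ≡ + (n C k) + + (n C suc k)
  pascalℤ n k = trans (cong +_ (sym (nCk+nC[k+1]≡[n+1]C[k+1] n k))) (ZP.pos-+ (n C k) (n C suc k))
  regroup : ∀ c d e → + 2 * (c + d) - c + e ≡ (c + d) + (d + e)
  regroup = solve-∀

target : ℕ → ℕ → ℤ
target X k = + ((2 N.* X N.+ k N.+ 1) C k)

target-step : ∀ X k → + 2 * target X (suc k) - target X k + + ((2 N.* X N.+ k N.+ 1) C suc (suc k))
                      ≡ target X (suc (suc k))
target-step X k = begin
  + 2 * target X (suc k) - target X k + + (n C suc (suc k))
    ≡⟨ cong (λ m → + 2 * + (m C suc k) - target X k + + (n C suc (suc k))) (index-1 X k) ⟩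
  + 2 * + (suc n C suc k) - + (n C k) + + (n C suc (suc k))
    ≡⟨ pascal-second n k ⟩
  + (suc (suc n) C suc (suc k))
    ≡⟨ cong (λ m → + (m C suc (suc k))) (index-2 X k) ⟨
  target X (suc (suc k)) ∎
  where
  n = 2 N.* X N.+ k N.+ 1
  index-1 : ∀ X k → 2 N.* X N.+ suc k N.+ 1 ≡ suc (2 N.* X N.+ k N.+ 1)
  index-1 = NSolver.solve-∀
  index-2 : ∀ X k → 2 N.* X N.+ suc (suc k) N.+ 1 ≡ suc (suc (2 N.* X N.+ k N.+ 1))
  index-2 = NSolver.solve-∀

-- The theorem in transformed form, Sub (multiset X) k = C(2X+k+1, k), by
-- induction on (X, k) lexicographically, together with the value of Δ on the
-- Pascal remainder (which refers back to the case X - 1).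
mutual
  Sub-multiset : ∀ X k → Sub (multiset X) k ≡ target X k
  Sub-multiset X zero = Sub-0 (multiset X)
  Sub-multiset X (suc zero) = begin
    Sub (multiset X) 1        ≡⟨ Sub-1 (multiset X) ⟩
    + 2 * + ((X N.+ 1) C 1)   ≡⟨ cong (λ x → + 2 * + x) (nC1≡n (X N.+ 1)) ⟩
    + 2 * + (X N.+ 1)         ≡⟨ ZP.pos-* 2 (X N.+ 1) ⟨
    + (2 N.* (X N.+ 1))       ≡⟨ cong +_ (index X) ⟩
    + (2 N.* X N.+ 1 N.+ 1)   ≡⟨ cong +_ (nC1≡n _) ⟨
    target X 1                ∎
    where
    index : ∀ X → 2 N.* (X N.+ 1) ≡ 2 N.* X N.+ 1 N.+ 1
    index = NSolver.solve-∀
  Sub-multiset X (suc (suc k)) = begin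
    Sub (multiset X) (suc (suc k))
      ≡⟨ Sub-step (multiset X) k ⟩
    Δ (shift (multiset X)) k
      ≡⟨ Δ-+ _ (multiset X) (remainder X) k (multiset-pascal X) ⟩
    Δ (multiset X) k + Δ (remainder X) k
      ≡⟨ cong₂ _+_ (cong₂ (λ x y → + 2 * x - y) (Sub-multiset X (suc k)) (Sub-multiset X k))
                   (Δ-remainder X k) ⟩
    + 2 * target X (suc k) - target X k + + ((2 N.* X N.+ k N.+ 1) C suc (suc k))
      ≡⟨ target-step X k ⟩
    target X (suc (suc k)) ∎

  Δ-remainder : ∀ X k → Δ (remainder X) k ≡ + ((2 N.* X N.+ k N.+ 1) C suc (suc k))
  Δ-remainder zero k = begin
    + 2 * Sub (remainder 0) (suc k) - Sub (remainder 0) k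
      ≡⟨ cong₂ (λ x y → + 2 * x - y) (Sub-zero _ (suc k) remainder-0) (Sub-zero _ k remainder-0) ⟩
    + 0
      ≡⟨ cong +_ (k>n⇒nCk≡0 (s≤s (NP.≤-reflexive (NP.+-comm k 1)))) ⟨
    + ((k N.+ 1) C suc (suc k)) ∎
  Δ-remainder (suc Y) k = begin
    Δ (remainder (suc Y)) k
      ≡⟨ cong₂ (λ x y → + 2 * x - y) (Sub-cong _ _ (suc k) (remainder-suc Y))
                                     (Sub-cong _ _ k (remainder-suc Y)) ⟩
    Δ (shift (multiset Y)) k
      ≡⟨ Sub-step (multiset Y) k ⟨
    Sub (multiset Y) (suc (suc k))
      ≡⟨ Sub-multiset Y (suc (suc k)) ⟩
    target Y (suc (suc k))
      ≡⟨ cong (λ n → + (n C suc (suc k))) (index Y k) ⟩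
    + ((2 N.* suc Y N.+ k N.+ 1) C suc (suc k)) ∎
    where
    index : ∀ Y k → 2 N.* Y N.+ suc (suc k) N.+ 1 ≡ 2 N.* suc Y N.+ k N.+ 1
    index = NSolver.solve-∀

coeff-reindex : ∀ k j N → sign j * (+ (2 N.^ (k ∸ 2 N.* j) N.* ((k ∸ j) C j) N.* N))
                          ≡ coeff (k ∸ j) j * + N
coeff-reindex k j N = begin
  sign j * + (2 N.^ (k ∸ 2 N.* j) N.* ((k ∸ j) C j) N.* N)
    ≡⟨ cong (λ e → sign j * + (2 N.^ e N.* ((k ∸ j) C j) N.* N)) k∸2j ⟩
  sign j * + (2 N.^ (k ∸ j ∸ j) N.* ((k ∸ j) C j) N.* N)
    ≡⟨ cong (sign j *_) (ZP.pos-* (2 N.^ (k ∸ j ∸ j) N.* ((k ∸ j) C j)) N) ⟩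
  sign j * (+ (2 N.^ (k ∸ j ∸ j) N.* ((k ∸ j) C j)) * + N)
    ≡⟨ ZP.*-assoc (sign j) (+ (2 N.^ (k ∸ j ∸ j) N.* ((k ∸ j) C j))) (+ N) ⟨
  coeff (k ∸ j) j * + N ∎
  where
  k∸2j : k ∸ 2 N.* j ≡ k ∸ j ∸ j
  k∸2j = trans (cong (λ z → k ∸ (j N.+ z)) (NP.+-identityʳ j)) (sym (NP.∸-+-assoc k j j))

lemma12 : (X k : ℕ) →
    sumTo (k / 2) (λ j → sign j * (+ (2 N.^ (k ∸ 2 N.* j) N.* ((k ∸ j) C j) N.* ((X N.+ (k ∸ j)) C (k ∸ j)))))
      ≡ + ((2 N.* X N.+ k N.+ 1) C k)
lemma12 X k = begin
  sumTo (k / 2) term            ≡⟨ sumTo-truncate k term (m/n≤m k 2) vanishes ⟨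
  sumTo k term                  ≡⟨ sumTo-cong k term _ (λ j _ → reindex j) ⟩
  sumTo k (λ j → F (k ∸ j) j)   ≡⟨ antidiag-sumTo k F ⟨
  Sub (multiset X) k            ≡⟨ Sub-multiset X k ⟩
  target X k                    ∎
  where
  term : ℕ → ℤ
  term j = sign j * (+ (2 N.^ (k ∸ 2 N.* j) N.* ((k ∸ j) C j) N.* ((X N.+ (k ∸ j)) C (k ∸ j))))
  F : ℕ → ℕ → ℤ
  F m j = coeff m j * multiset X m
  reindex : ∀ j → term j ≡ F (k ∸ j) j
  reindex j = coeff-reindex k j ((X N.+ (k ∸ j)) C (k ∸ j))
  vanishes : ∀ i → k / 2 < i → i ≤ k → term i ≡ + 0
  vanishes i@(suc _) k/2<i _ = begin
    term i                        ≡⟨ reindex i ⟩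
    coeff (k ∸ i) i * multiset X (k ∸ i)
      ≡⟨ cong (_* multiset X (k ∸ i)) (coeff-vanishes (NP.m<n+o⇒m∸n<o k i (k/2<i⇒k<i+i k i k/2<i))) ⟩
    + 0 * multiset X (k ∸ i)      ≡⟨⟩
    + 0                           ∎
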